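{- Let $p$ be an odd prime. Let $(\ell_n)_{n\geq0}$ be a sequence of positive integers, put $\ell_{ -1}=\ell_{ -2}=0$ and define $f(n)=\sum_{j=0}^{n}\ell_j$. Let $[(a_0,a_1,\ldots),(b_0,b_1,\ldots)]$ be an infinite $p$-adic MCF, the expansion of $(\alpha,\beta)\in\mathbb{Q}_p^2$, satisfying $h_{n+1}\geq\ell_n$ and $k_{n+1}\geq\ell_n+\ell_{n-1}$ for all $n\geq0$. Then for every $n\in\mathbb{N}$, \[\min\{\nu_p(V_n^\alpha),\nu_p(V_n^\beta)\}\geq f(n).\]
   Context: $\nu_p$ denotes the $p$-adic valuation (with $\nu_p(0)=+\infty$). Browkin's $s$-function $s:\mathbb{Q}_p\to\mathbb{Z}[1/p]\cap(-p/2,p/2)$ is $s(\alpha)=\sum_{j=k}^{0}x_jp^j$ where $\alpha=\sum_{j=k}^\infty x_jp^j$, $x_j\in\mathbb{Z}\cap(-p/2,p/2)$ (empty sum $=0$ if $k>0$). The $p$-adic Jacobi–Perron algorithm applied to $(\alpha,\beta)$: $\alpha_0=\alpha,\beta_0=\beta$, and for $k\geq0$: $a_k=s(\alpha_k)$, $b_k=s(\beta_k)$, and if $\beta_k\neq b_k$, $\alpha_{k+1}=1/(\beta_k-b_k)$, $\beta_{k+1}=(\alpha_k-a_k)/(\beta_k-b_k)$; if $\beta_k=b_k$ it stops. The MCF $[(a_0,a_1,\ldots),(b_0,b_1,\ldots)]$ is infinite if the algorithm never stops. Define $A_{ -2}=0,A_{ -1}=1,A_0=a_0$; $B_{ -2}=1,B_{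 -1}=0,B_0=b_0$; $C_{ -2}=0,C_{ -1}=0,C_0=1$, and for $n\geq1$: $X_n=a_nX_{n-1}+b_nX_{n-2}+X_{n-3}$ for $X\in\{A,B,C\}$. Set $V_n^\alpha=C_n\alpha-A_n$, $V_n^\beta=C_n\beta-B_n$. For $n\geq1$: $k_n=\nu_p(1/a_n)$ and $h_n=\nu_p(b_n/a_n)$ (so $h_n=+\infty$ if $b_n=0$). -}

module Defs where

open import Data.Nat as ℕ using (ℕ; zero; suc; NonZero)
open import Data.Nat.Divisibility as ℕD using ()
open import Data.Integer as ℤ using (ℤ; +_)
open import Data.Integer.Divisibility as ℤD using ()
open import Data.Integer.DivMod using (_/ℕ_; _%ℕ_)
open import Data.Product using (_×_; _,_; proj₁; proj₂)
open import Relation.Nullary using (¬_; yes; no)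
open import Relation.Nullary.Decidable using (⌊_⌋)
open import Relation.Binary.PropositionalEquality using (_≡_)
open import Data.Bool using (if_then_else_)

-- A p-adic integer is represented by a sequence x : ℕ → ℤ of
-- approximations with  p^n ∣ x (n+1) - x n  ("coherent"); x n is then
-- a representative of the residue of the p-adic integer modulo p^n.
-- A p-adic number is a pair (e , x) standing for p^(-e) · x.
-- Operations are on raw representatives; equality is the setoid _≈_.

record Qp : Set where
  constructor qp
  field
    e : ℕ
    x : ℕ → ℤ
open Qp public

pw : ℕ → ℕ → ℤ
pw p k = + (p ℕ.^ k)

Coherent : ℕ → Qp → Set
Coherent p q = ∀ n → pw p n ℤD.∣ (x q (suc n) ℤ.- x q n)

module _ (p : ℕ) where

  _≈_ : Qp → Qp → Set
  qp e₁ x₁ ≈ qp e₂ x₂ = ∀ n → pw p n ℤD.∣ (pw p e₂ ℤ.* x₁ n ℤ.- pw p e₁ ℤ.* x₂ n)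

  _+Q_ : Qp → Qp → Qp
  qp e₁ x₁ +Q qp e₂ x₂ = qp (e₁ ℕ.+ e₂) (λ n → pw p e₂ ℤ.* x₁ n ℤ.+ pw p e₁ ℤ.* x₂ n)

  _-Q_ : Qp → Qp → Qp
  qp e₁ x₁ -Q qp e₂ x₂ = qp (e₁ ℕ.+ e₂) (λ n → pw p e₂ ℤ.* x₁ n ℤ.- pw p e₁ ℤ.* x₂ n)

  _*Q_ : Qp → Qp → Qp
  qp e₁ x₁ *Q qp e₂ x₂ = qp (e₁ ℕ.+ e₂) (λ n → x₁ n ℤ.* x₂ n)

  -- ν_p(q) ≥ m  (m ∈ ℤ):  p^(-e) x ∈ p^m ℤ_p,  i.e. x ≡ 0 mod p^(m+e)
  -- (vacuous when m + e ≤ 0; for m + e = k ≥ 0 uses the approximation x k).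
  ValGe : Qp → ℤ → Set
  ValGe q m = ∀ (k : ℕ) → + k ≡ m ℤ.+ + (e q) → pw p k ℤD.∣ x q k

-- Elements of ℤ[1/p]:  num / p^den

record ZP : Set where
  constructor zp
  field
    num : ℤ
    den : ℕ
open ZP public

ι : ZP → Qp
ι (zp r d) = qp d (λ _ → r)

1Q : Qp
1Q = ι (zp (+ 1) 0)

0Q : Qp
0Q = ι (zp (+ 0) 0)

module _ (p : ℕ) .{{_ : NonZero p}} where

  -- balanced residue of z modulo p, in (-p/2, p/2)  (p odd)
  bal : ℤ → ℤ
  bal z with (z %ℕ p) ℕ.≤? (p ℕ./ 2)
  ... | yes _ = + (z %ℕ p)
  ... | no  _ = + (z %ℕ p) ℤ.- + p

  -- Σ_{j<m} d_j p^j, where z = Σ_j d_j p^j is the balanced base-p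
  -- (p-adic) digit expansion of the integer z, d_j ∈ ℤ ∩ (-p/2, p/2)
  digitSum : ℕ → ℤ → ℤ
  digitSum zero    z = + 0
  digitSum (suc m) z = bal z ℤ.+ + p ℤ.* digitSum m ((z ℤ.- bal z) /ℕ p)

  -- For α = p^(-e) x, the digits of α at
  -- positions -e,…,0 are the digits 0,…,e of the p-adic integer x,
  -- which are determined by the approximation x (e+1).
  -- s(α) = Σ_{j=-e}^{0} d_{j+e} p^j = (Σ_{i≤e} d_i p^i) / p^e.
  s : Qp → ZP
  s (qp e₀ x₀) = zp (digitSum (suc e₀) (x₀ (suc e₀))) e₀

  -- exact p-adic valuation of a positive natural number (fuel-bounded;
  -- fuel n suffices since ν_p(n) ≤ n)
  νℕ-fuel : ℕ → ℕ → ℕ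
  νℕ-fuel zero    n = 0
  νℕ-fuel (suc f) n =
    if ⌊ p ℕD.∣? n ⌋ then suc (νℕ-fuel f (n ℕ./ p)) else 0

  νℕ : ℕ → ℕ
  νℕ n = νℕ-fuel n n

data ℤ∞ : Set where
  fin : ℤ → ℤ∞
  ∞   : ℤ∞

infix 4 _≥∞_
data _≥∞_ : ℤ∞ → ℤ → Set where
  ∞≥  : ∀ {m} → ∞ ≥∞ m
  fin≥ : ∀ {v m} → m ℤ.≤ v → fin v ≥∞ m

module _ (p : ℕ) .{{_ : NonZero p}} where

  νZP : ZP → ℤ∞
  νZP (zp (+ zero) d) = ∞
  νZP (zp r d) = fin (+ νℕ p ℤ.∣ r ∣ ℤ.- + d)

  -- ν_p(1/a) = -ν_p(a)   (a ≠ 0; a = 0 never occurs for a_n, n ≥ 1)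
  νinv : ZP → ℤ∞
  νinv a with νZP a
  ... | fin v = fin (ℤ.- v)
  ... | ∞     = ∞

  -- ν_p(b/a) = ν_p(b) - ν_p(a)   (+∞ if b = 0; a ≠ 0 as above)
  νquot : ZP → ZP → ℤ∞
  νquot b a with νZP b | νZP a
  ... | fin u | fin v = fin (u ℤ.- v)
  ... | _     | _     = ∞

-- The p-adic Jacobi–Perron algorithm, infinite run.
-- (αs k , βs k) = (α_k , β_k); a_k = s(α_k), b_k = s(β_k).

module _ (p : ℕ) .{{_ : NonZero p}} where

  aseq : (ℕ → Qp) → ℕ → ZP
  aseq αs k = s p (αs k)

  record InfiniteJP (αs βs : ℕ → Qp) : Set where
    field
      coh-α   : ∀ k → Coherent p (αs k)
      coh-β   : ∀ k → Coherent p (βs k)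
      -- the algorithm never stops: β_k ≠ b_k
      nonstop : ∀ k → ¬ (_≈_ p (βs k) (ι (s p (βs k))))
      step-α  : ∀ k → _≈_ p (_*Q_ p (αs (suc k)) (_-Q_ p (βs k) (ι (s p (βs k))))) 1Q
      step-β  : ∀ k → _≈_ p (_*Q_ p (βs (suc k)) (_-Q_ p (βs k) (ι (s p (βs k)))))
                              (_-Q_ p (αs k) (ι (s p (αs k))))

  -- X_n = a_n X_{n-1} + b_n X_{n-2} + X_{n-3}, returned as
  -- (X_n , X_{n-1} , X_{n-2}) from initial (X_0 , X_{-1} , X_{-2}).
  conv : (a b : ℕ → ZP) → Qp × Qp × Qp → ℕ → Qp × Qp × Qp
  conv a b ini zero = ini
  conv a b ini (suc n) with conv a b ini n
  ... | (x₀ , x₁ , x₂) =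
    (_+Q_ p (_+Q_ p (_*Q_ p (ι (a (suc n))) x₀) (_*Q_ p (ι (b (suc n))) x₁)) x₂ , x₀ , x₁)

  module JP (αs βs : ℕ → Qp) where
    a b : ℕ → ZP
    a k = s p (αs k)
    b k = s p (βs k)

    A B C : ℕ → Qp
    A n = proj₁ (conv a b (ι (a 0) , 1Q , 0Q) n)
    B n = proj₁ (conv a b (ι (b 0) , 0Q , 1Q) n)
    C n = proj₁ (conv a b (1Q , 0Q , 0Q) n)

    Vα Vβ : ℕ → Qp
    Vα n = _-Q_ p (_*Q_ p (C n) (αs 0)) (A n)
    Vβ n = _-Q_ p (_*Q_ p (C n) (βs 0)) (B n)

    kk hh : ℕ → ℤ∞
    kk n = νinv p (a n)
    hh n = νquot p (b n) (a n)

prevℓ : (ℕ → ℕ) → ℕ → ℕ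
prevℓ ℓ zero    = 0
prevℓ ℓ (suc n) = ℓ n

fsum : (ℕ → ℕ) → ℕ → ℕ
fsum ℓ zero    = ℓ 0
fsum ℓ (suc n) = fsum ℓ n ℕ.+ ℓ (suc n)

module Submission where

-- Write D_k = α_k − a_k and E_k = β_k − b_k, so that the algorithm reads
-- α_{k+1} E_k = 1 and β_{k+1} E_k = D_k.  The argument has three layers.
--  * Algebra (valid in every commutative ring): the remainders obey the
--    convergent recurrence and the invariant α_{n+1}V_n + β_{n+1}V_{n-1}
--    + V_{n-2} = 0, hence V_{n+1} = −(D_{n+1} V_n + E_{n+1} V_{n-1}).
--  * Valuations: ν(E_k) ≥ −ν(a_{k+1}) = k_{k+1} ≥ ℓ_k + ℓ_{k-1}, and from
--    D_k = (b_{k+1} + E_{k+1}) E_k also ν(D_k) ≥ ℓ_k; an induction on the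
--    recursion above then gives ν(V_n) ≥ f(n) and ν(V_{n-1}) ≥ f(n-1).
--  * Representations: ℚ_p is modelled by coherent sequences of residues;
--    they form a commutative ring up to the equality of the definitions,
--    on which "ν ≥ m" is a divisibility condition closed under the ring
--    operations.

open import Defs hiding (_≈_)
import Defs
open import Data.Nat as ℕ using (ℕ; zero; suc)
import Data.Nat.Properties as ℕP
open import Data.Integer as ℤ using (ℤ; +_)
import Data.Integer.Properties as ℤP
import Data.Integer.Divisibility as ℤD
open import Data.Integer.Divisibility.Signed as ∣ using (divides)
open import Data.Integer.Tactic.RingSolver using (solve-∀)
open import Data.Product using (_×_; _,_; proj₁; proj₂; Σ)
open import Relation.Binary.PropositionalEquality
  using (_≡_; _≢_; refl; sym; trans; cong; cong₂; subst)
open import Data.Nat.Primality using (Prime)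
open import Algebra.Bundles using (CommutativeRing; RawRing)
open import Algebra.Solver.Ring.AlmostCommutativeRing
  using (_-Raw-AlmostCommutative⟶_; fromCommutativeRing; Induced-equivalence)

ℤ-rawRing : RawRing _ _
ℤ-rawRing = CommutativeRing.rawRing ℤP.+-*-commutativeRing

-- The ring solver for a commutative ring R, with integer coefficients
-- mapped into R by a homomorphism; integer coefficients are compared by
-- decidable equality, which is what lets the normaliser cancel them.
module IntegerCoefficientSolver {c ℓ} (R : CommutativeRing c ℓ)
  (ℤ⟶R : ℤ-rawRing -Raw-AlmostCommutative⟶ fromCommutativeRing R) where
  open import Relation.Binary.Definitions using (WeaklyDecidable)
  open import Relation.Nullary using (yes; no)
  open import Data.Maybe using (just; nothing)

  coefficient-≟ : WeaklyDecidable (Induced-equivalence ℤ⟶R)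
  coefficient-≟ i j with i ℤ.≟ j
  ... | yes refl = just (CommutativeRing.refl R)
  ... | no _     = nothing

  open import Algebra.Solver.Ring ℤ-rawRing (fromCommutativeRing R) ℤ⟶R coefficient-≟ public

module PowersOfP (p : ℕ) .{{_ : ℕ.NonZero p}} where
  open import Data.Integer using (_+_; _-_; _*_; -_)
  open ∣ using (_∣_)

  P : ℕ → ℤ
  P = pw p

  P-nonZero : ∀ k → ℤ.NonZero (P k)
  P-nonZero k = ℕP.m^n≢0 p k

  P-+ : ∀ i j → P (i ℕ.+ j) ≡ P i * P j
  P-+ i j = trans (cong +_ (ℕP.^-distribˡ-+-* p i j)) (ℤP.pos-* (p ℕ.^ i) (p ℕ.^ j))

  P-mono : ∀ {i j} → i ℕ.≤ j → P i ∣ P j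
  P-mono {i} {j} i≤j = divides (P (j ℕ.∸ i)) (trans (cong P (sym (ℕP.m+[n∸m]≡n i≤j)))
                                                   (trans (P-+ i (j ℕ.∸ i)) (ℤP.*-comm (P i) _)))

  ∣-resp : ∀ {a b c} → b ≡ c → a ∣ b → a ∣ c
  ∣-resp eq h = subst (_ ∣_) eq h

  ∣-zero : ∀ a → a ∣ + 0
  ∣-zero a = divides (+ 0) (sym (ℤP.*-zeroˡ a))

  ∣-weaken : ∀ {i j a} → i ℕ.≤ j → P j ∣ a → P i ∣ a
  ∣-weaken i≤j h = ∣.∣-trans (P-mono i≤j) h

  P-cancel : ∀ k j a → P (k ℕ.+ j) ∣ P k * a → P j ∣ a
  P-cancel k j a h = ∣.*-cancelˡ-∣ (P k) {{P-nonZero k}} (subst (_∣ P k * a) (P-+ k j) h)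

  P-scale : ∀ k j a → P j ∣ a → P (k ℕ.+ j) ∣ P k * a
  P-scale k j a h = subst (_∣ P k * a) (sym (P-+ k j)) (∣.*-monoʳ-∣ (P k) h)

  P-product : ∀ {i j a b} → P i ∣ a → P j ∣ b → P (i ℕ.+ j) ∣ a * b
  P-product {i} {j} (divides q refl) (divides r refl) =
    divides (q * r) (trans (rearrange q (P i) r (P j)) (cong (q * r *_) (sym (P-+ i j))))
    where
    rearrange : ∀ q a r b → q * a * (r * b) ≡ q * r * (a * b)
    rearrange = solve-∀

  CoherentSeq : (ℕ → ℤ) → Set
  CoherentSeq x = ∀ n → pw p n ℤD.∣ (x (suc n) - x n)

  coherent-step : ∀ {x} → CoherentSeq x → ∀ n → P n ∣ x (suc n) - x n
  coherent-step {x} c n = ∣.∣ᵤ⇒∣ {P n} {x (suc n) - x n} (c n)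

  coherent-gap : ∀ {x} → CoherentSeq x → ∀ {i j} → i ℕ.≤ j → P i ∣ x j - x i
  coherent-gap {x} c {i} i≤j = gap (ℕP.≤⇒≤′ i≤j)
    where
    telescope : ∀ a b c → a - b + (b - c) ≡ a - c
    telescope = solve-∀
    gap : ∀ {j} → i ℕ.≤′ j → P i ∣ x j - x i
    gap ℕ.≤′-refl = ∣-resp (sym (ℤP.+-inverseʳ (x i))) (∣-zero (P i))
    gap (ℕ.≤′-step {j} i≤′j) =
      ∣-resp (telescope (x (suc j)) (x j) (x i))
        (∣.∣m∣n⇒∣m+n (∣-weaken {j = j} (ℕP.≤′⇒≤ i≤′j) (coherent-step {x} c j)) (gap i≤′j))

  residue-transport : ∀ {x} → CoherentSeq x → ∀ {i j k} → i ℕ.≤ j → i ℕ.≤ k →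
                      P i ∣ x j → P i ∣ x k
  residue-transport {x} c {i} {j} {k} i≤j i≤k h =
    ∣-resp (cancel (x k) (x i) (x j))
      (∣.∣m∣n⇒∣m+n (coherent-gap {x} c i≤k) (∣.∣m∣n⇒∣m-n h (coherent-gap {x} c i≤j)))
    where
    cancel : ∀ a b c → a - b + (c - (c - b)) ≡ a
    cancel = solve-∀

  residue-restrict : ∀ {x} → CoherentSeq x → ∀ {i j} → i ℕ.≤ j → P j ∣ x j → P i ∣ x i
  residue-restrict {x} c {j = j} i≤j h = residue-transport {x} c i≤j ℕP.≤-refl (∣-weaken {j = j} i≤j h)

module ConvergentAlgebra {c ℓ} (R : CommutativeRing c ℓ)
  (ℤ⟶R : ℤ-rawRing -Raw-AlmostCommutative⟶ fromCommutativeRing R) where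
  open CommutativeRing R renaming (refl to ≈-refl; sym to ≈-sym; trans to ≈-trans)
  open IntegerCoefficientSolver R ℤ⟶R using (solve; _:=_; _:+_; _:-_; _:*_; :-_)
  open import Algebra.Properties.Ring (CommutativeRing.ring R) using (-0#≈0#)
  open import Relation.Binary.Reasoning.Setoid setoid

  Triple : Set c
  Triple = Carrier × Carrier × Carrier

  convergents : (ℕ → Carrier) → (ℕ → Carrier) → Triple → ℕ → Triple
  convergents a b X₀ zero = X₀
  convergents a b X₀ (suc n) = a (suc n) * proj₁ t + b (suc n) * proj₁ (proj₂ t) + proj₂ (proj₂ t)
                             , proj₁ t , proj₁ (proj₂ t)
    where t = convergents a b X₀ n

  module Expansion (a b α β : ℕ → Carrier)
    (step-α : ∀ k → α (suc k) * (β k - b k) ≈ 1#)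
    (step-β : ∀ k → β (suc k) * (β k - b k) ≈ α k - a k) where

    D E : ℕ → Carrier
    D k = α k - a k
    E k = β k - b k

    -- D_k = β_{k+1} E_k = (b_{k+1} + E_{k+1}) E_k
    D-split : ∀ k → D k ≈ b (suc k) * E k + E (suc k) * E k
    D-split k = begin
      D k                               ≈⟨ ≈-sym (step-β k) ⟩
      β (suc k) * E k                   ≈⟨ regroup (β (suc k)) (b (suc k)) (E k) ⟩
      b (suc k) * E k + E (suc k) * E k ∎
      where
      regroup : ∀ β′ b′ E → β′ * E ≈ b′ * E + (β′ - b′) * E
      regroup = solve 3 (λ β′ b′ E → β′ :* E := b′ :* E :+ (β′ :- b′) :* E) ≈-refl

    -- The remainders V_n = C_n γ − X_n, where C are the convergents started
    -- at (1, 0, 0) and X those started at X₀; V′ and V″ are V_{n-1}, V_{n-2}.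
    module Remainders (γ : Carrier) (X₀ : Triple) where
      C X : ℕ → Triple
      C = convergents a b (1# , 0# , 0#)
      X = convergents a b X₀

      V V′ V″ : ℕ → Carrier
      V  n = proj₁ (C n) * γ - proj₁ (X n)
      V′ n = proj₁ (proj₂ (C n)) * γ - proj₁ (proj₂ (X n))
      V″ n = proj₂ (proj₂ (C n)) * γ - proj₂ (proj₂ (X n))

      Invariant : ℕ → Set ℓ
      Invariant n = α (suc n) * V n + β (suc n) * V′ n + V″ n ≈ 0#

      V-recurrence : ∀ n → V (suc n) ≈ a (suc n) * V n + b (suc n) * V′ n + V″ n
      V-recurrence n = linear (a (suc n)) (b (suc n))
        (proj₁ (C n)) (proj₁ (proj₂ (C n))) (proj₂ (proj₂ (C n))) γ
        (proj₁ (X n)) (proj₁ (proj₂ (X n))) (proj₂ (proj₂ (X n)))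
        where
        linear : ∀ A B c₀ c₁ c₂ g x₀ x₁ x₂ →
                 (A * c₀ + B * c₁ + c₂) * g - (A * x₀ + B * x₁ + x₂)
                 ≈ A * (c₀ * g - x₀) + B * (c₁ * g - x₁) + (c₂ * g - x₂)
        linear = solve 9 (λ A B c₀ c₁ c₂ g x₀ x₁ x₂ →
          (A :* c₀ :+ B :* c₁ :+ c₂) :* g :- (A :* x₀ :+ B :* x₁ :+ x₂)
          := A :* (c₀ :* g :- x₀) :+ B :* (c₁ :* g :- x₁) :+ (c₂ :* g :- x₂)) ≈-refl

      V-step : ∀ n → Invariant n → V (suc n) ≈ - (D (suc n) * V n + E (suc n) * V′ n)
      V-step n inv = begin
        V (suc n)                                    ≈⟨ V-recurrence n ⟩
        a′ * V n + b′ * V′ n + V″ n                  ≈⟨ split a′ b′ α′ β′ (V n) (V′ n) (V″ n) ⟩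
        - (D′ * V n + E′ * V′ n) + (α′ * V n + β′ * V′ n + V″ n) ≈⟨ +-congˡ inv ⟩
        - (D′ * V n + E′ * V′ n) + 0#                ≈⟨ +-identityʳ _ ⟩
        - (D′ * V n + E′ * V′ n)                     ∎
        where
        a′ = a (suc n) ; b′ = b (suc n) ; α′ = α (suc n) ; β′ = β (suc n)
        D′ = D (suc n) ; E′ = E (suc n)
        split : ∀ a′ b′ α′ β′ v v′ v″ → a′ * v + b′ * v′ + v″
              ≈ - ((α′ - a′) * v + (β′ - b′) * v′) + (α′ * v + β′ * v′ + v″)
        split = solve 7 (λ a′ b′ α′ β′ v v′ v″ → a′ :* v :+ b′ :* v′ :+ v″
              := :- ((α′ :- a′) :* v :+ (β′ :- b′) :* v′) :+ (α′ :* v :+ β′ :* v′ :+ v″)) ≈-refl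

      -- the invariant propagates, by α_{n+2} E_{n+1} = 1 and β_{n+2} E_{n+1} = D_{n+1}
      invariant-step : ∀ n → Invariant n → Invariant (suc n)
      invariant-step n inv = begin
        α″ * V (suc n) + β″ * V n + V′ n
          ≈⟨ +-congʳ (+-congʳ (*-congˡ (V-step n inv))) ⟩
        α″ * - (D′ * V n + E′ * V′ n) + β″ * V n + V′ n
          ≈⟨ expand α″ β″ D′ E′ (V n) (V′ n) ⟩
        w - α″ * E′ * w + α″ * V n * (β″ * E′ - D′)
          ≈⟨ +-cong (+-congˡ (-‿cong (*-congʳ (step-α (suc n))))) (*-congˡ (+-congʳ (step-β (suc n)))) ⟩
        w - 1# * w + α″ * V n * (D′ - D′)
          ≈⟨ +-cong (+-congˡ (-‿cong (*-identityˡ w))) (*-congˡ (-‿inverseʳ D′)) ⟩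
        w - w + α″ * V n * 0#
          ≈⟨ +-cong (-‿inverseʳ w) (zeroʳ _) ⟩
        0# + 0#
          ≈⟨ +-identityʳ 0# ⟩
        0#  ∎
        where
        α″ = α (suc (suc n)) ; β″ = β (suc (suc n))
        D′ = D (suc n) ; E′ = E (suc n)
        w = V′ n + β″ * V n
        expand : ∀ α″ β″ D′ E′ v v′ → α″ * - (D′ * v + E′ * v′) + β″ * v + v′
               ≈ (v′ + β″ * v) - α″ * E′ * (v′ + β″ * v) + α″ * v * (β″ * E′ - D′)
        expand = solve 6 (λ α″ β″ D′ E′ v v′ → α″ :* :- (D′ :* v :+ E′ :* v′) :+ β″ :* v :+ v′
               := (v′ :+ β″ :* v) :- α″ :* E′ :* (v′ :+ β″ :* v) :+ α″ :* v :* (β″ :* E′ :- D′)) ≈-refl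

      -- initially V_0 = γ − X_0, V_{-1} = −X_{-1}, V_{-2} = −X_{-2}
      invariant-initial : α 1 * (γ - proj₁ X₀) + β 1 * - proj₁ (proj₂ X₀) + - proj₂ (proj₂ X₀) ≈ 0# →
                          Invariant 0
      invariant-initial h = begin
        α 1 * (1# * γ - x₀) + β 1 * (0# * γ - x₁) + (0# * γ - x₂)
          ≈⟨ +-cong (+-cong (*-congˡ (+-congʳ (*-identityˡ γ))) (*-congˡ (from-zero x₁))) (from-zero x₂) ⟩
        α 1 * (γ - x₀) + β 1 * - x₁ + - x₂
          ≈⟨ h ⟩
        0# ∎
        where
        x₀ = proj₁ X₀ ; x₁ = proj₁ (proj₂ X₀) ; x₂ = proj₂ (proj₂ X₀)
        from-zero : ∀ u → 0# * γ - u ≈ - u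
        from-zero u = ≈-trans (+-congʳ (zeroˡ γ)) (+-identityˡ (- u))

      remainder-recursion : Invariant 0 → ∀ n → V (suc n) ≈ - (D (suc n) * V n + E (suc n) * V′ n)
      remainder-recursion inv₀ n = V-step n (invariant n)
        where
        invariant : ∀ n → Invariant n
        invariant zero    = inv₀
        invariant (suc n) = invariant-step n (invariant n)

    invariant-α : Remainders.Invariant (α 0) (a 0 , 1# , 0#) 0
    invariant-α = Remainders.invariant-initial (α 0) (a 0 , 1# , 0#) (begin
      α₁ * D 0 + β₁ * - 1# + - 0#          ≈⟨ +-congʳ (+-congʳ (*-congˡ (≈-sym (step-β 0)))) ⟩
      α₁ * (β₁ * E 0) + β₁ * - 1# + - 0#   ≈⟨ factor α₁ β₁ (E 0) 1# 0# ⟩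
      β₁ * (α₁ * E 0 - 1#) - 0#            ≈⟨ +-congʳ (*-congˡ (+-congʳ (step-α 0))) ⟩
      β₁ * (1# - 1#) - 0#                  ≈⟨ +-congʳ (*-congˡ (-‿inverseʳ 1#)) ⟩
      β₁ * 0# - 0#                         ≈⟨ +-congʳ (zeroʳ β₁) ⟩
      0# - 0#                              ≈⟨ -‿inverseʳ 0# ⟩
      0#                                   ∎)
      where
      α₁ = α 1 ; β₁ = β 1
      factor : ∀ u v w o z → u * (v * w) + v * - o + - z ≈ v * (u * w - o) - z
      factor = solve 5 (λ u v w o z → u :* (v :* w) :+ v :* :- o :+ :- z := v :* (u :* w :- o) :- z) ≈-refl

    invariant-β : Remainders.Invariant (β 0) (b 0 , 0# , 1#) 0
    invariant-β = Remainders.invariant-initial (β 0) (b 0 , 0# , 1#) (begin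
      α 1 * E 0 + β 1 * - 0# + - 1#   ≈⟨ +-congʳ (+-cong (step-α 0) (*-congˡ -0#≈0#)) ⟩
      1# + β 1 * 0# + - 1#            ≈⟨ +-congʳ (+-congˡ (zeroʳ (β 1))) ⟩
      1# + 0# + - 1#                  ≈⟨ +-congʳ (+-identityʳ 1#) ⟩
      1# - 1#                         ≈⟨ -‿inverseʳ 1# ⟩
      0#                              ∎)

-- The operations are the
-- raw ones of the definitions, kept opaque so that terms stay small.
module CoherentRing (p : ℕ) .{{_ : ℕ.NonZero p}} where
  open PowersOfP p
  open import Data.Integer using (_+_; _-_; _*_; -_)
  open ∣ using (_∣_)
  open import Algebra.Structures using (IsCommutativeRing)
  open import Relation.Binary.Structures using (IsEquivalence)

  CQ : Set
  CQ = Σ Qp (Coherent p)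

  rep : CQ → Qp
  rep = proj₁

  -- _≈_ of the definitions, stated with signed divisibility
  SameValue : Qp → Qp → Set
  SameValue q r = ∀ n → P n ∣ P (e r) * x q n - P (e q) * x r n

  ≈⇒SameValue : ∀ {q r} → Defs._≈_ p q r → SameValue q r
  ≈⇒SameValue {q} {r} h n = ∣.∣ᵤ⇒∣ {P n} {P (e r) * x q n - P (e q) * x r n} (h n)

  SameValue⇒≈ : ∀ {q r} → SameValue q r → Defs._≈_ p q r
  SameValue⇒≈ h n = ∣.∣⇒∣ᵤ (h n)

  infix 4 _≋_
  record _≋_ (a b : CQ) : Set where
    constructor by-≈
    field ≋⇒≈ : Defs._≈_ p (rep a) (rep b)

  ≋-by-∣ : ∀ {a b} → SameValue (rep a) (rep b) → a ≋ b
  ≋-by-∣ {a} {b} h = by-≈ (SameValue⇒≈ {rep a} {rep b} h)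

  ≋-by-≡ : ∀ {a b} → (∀ n → P (e (rep b)) * x (rep a) n ≡ P (e (rep a)) * x (rep b) n) → a ≋ b
  ≋-by-≡ {a} {b} h = ≋-by-∣ {a} {b} λ n → ∣-resp (sym (trans (cong (_- P (e (rep a)) * x (rep b) n) (h n))
                                                         (ℤP.+-inverseʳ (P (e (rep a)) * x (rep b) n))))
                                             (∣-zero (P n))

  ≋-refl : ∀ {a} → a ≋ a
  ≋-refl = ≋-by-≡ (λ n → refl)

  ≋-sym : ∀ {a b} → a ≋ b → b ≋ a
  ≋-sym {q , _} {r , _} (by-≈ h) = by-≈ (SameValue⇒≈ {r} {q} λ n →
    ∣-resp (flip (P (e r) * x q n) (P (e q) * x r n)) (∣.∣m⇒∣-m (≈⇒SameValue {q} {r} h n)))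
    where
    flip : ∀ a b → - (a - b) ≡ b - a
    flip = solve-∀

  -- transitivity: compare at the precision e₂ + n and cancel p^e₂
  ≋-trans : ∀ {a b c} → a ≋ b → b ≋ c → a ≋ c
  ≋-trans {q₁ , c₁} {q₂ , c₂} {q₃ , c₃} (by-≈ h₁₂) (by-≈ h₂₃) = by-≈ (SameValue⇒≈ {q₁} {q₃} goal)
    where
    e₁ = e q₁ ; e₂ = e q₂ ; e₃ = e q₃
    U : ℕ → ℤ
    U n = P e₃ * x q₁ n - P e₁ * x q₃ n
    combine : ∀ a b c d f g → c * (b * d - a * f) + a * (c * f - b * g) ≡ b * (c * d - a * g)
    combine = solve-∀
    at-shifted : ∀ n → P (e₂ ℕ.+ n) ∣ P e₂ * U (e₂ ℕ.+ n)
    at-shifted n = ∣-resp (combine (P e₁) (P e₂) (P e₃) (x q₁ m) (x q₂ m) (x q₃ m))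
        (∣.∣m∣n⇒∣m+n (∣.∣n⇒∣m*n (P e₃) (≈⇒SameValue {q₁} {q₂} h₁₂ m))
                     (∣.∣n⇒∣m*n (P e₁) (≈⇒SameValue {q₂} {q₃} h₂₃ m)))
      where m = e₂ ℕ.+ n
    difference : ∀ a b c d f g → a * (c - d) - b * (f - g) ≡ (a * c - b * f) - (a * d - b * g)
    difference = solve-∀
    back : ∀ a b → a - (a - b) ≡ b
    back = solve-∀
    goal : SameValue q₁ q₃
    goal n = ∣-resp (back (U m) (U n)) (∣.∣m∣n⇒∣m-n (P-cancel e₂ n (U m) (at-shifted n))
               (∣-resp (difference (P e₃) (P e₁) (x q₁ m) (x q₁ n) (x q₃ m) (x q₃ n))
                 (∣.∣m∣n⇒∣m-n (∣.∣n⇒∣m*n (P e₃) (coherent-gap {x q₁} c₁ (ℕP.m≤n+m n e₂)))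
                              (∣.∣n⇒∣m*n (P e₁) (coherent-gap {x q₃} c₃ (ℕP.m≤n+m n e₂))))))
      where m = e₂ ℕ.+ n

  ≋-isEquivalence : IsEquivalence _≋_
  ≋-isEquivalence = record
    { refl = λ {a} → ≋-refl {a} ; sym = λ {a} {b} → ≋-sym {a} {b} ; trans = λ {a} {b} {c} → ≋-trans {a} {b} {c} }

  coherent : ∀ {q} → (∀ n → P n ∣ x q (suc n) - x q n) → Coherent p q
  coherent h n = ∣.∣⇒∣ᵤ (h n)

  infixl 6 _⊕_ _⊖_
  infixl 7 _⊗_
  opaque
    _⊕_ _⊖_ _⊗_ : CQ → CQ → CQ
    (q , cq) ⊕ (r , cr) = _+Q_ p q r , coherent {_+Q_ p q r} (λ n →
        ∣-resp (expand (P (e r)) (P (e q)) (x q (suc n)) (x q n) (x r (suc n)) (x r n))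
          (∣.∣m∣n⇒∣m+n (∣.∣n⇒∣m*n (P (e r)) (coherent-step {x q} cq n))
                       (∣.∣n⇒∣m*n (P (e q)) (coherent-step {x r} cr n))))
      where
      expand : ∀ a b c d f g → a * (c - d) + b * (f - g) ≡ (a * c + b * f) - (a * d + b * g)
      expand = solve-∀
    (q , cq) ⊖ (r , cr) = _-Q_ p q r , coherent {_-Q_ p q r} (λ n →
        ∣-resp (expand (P (e r)) (P (e q)) (x q (suc n)) (x q n) (x r (suc n)) (x r n))
          (∣.∣m∣n⇒∣m-n (∣.∣n⇒∣m*n (P (e r)) (coherent-step {x q} cq n))
                       (∣.∣n⇒∣m*n (P (e q)) (coherent-step {x r} cr n))))
      where
      expand : ∀ a b c d f g → a * (c - d) - b * (f - g) ≡ (a * c - b * f) - (a * d - b * g)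
      expand = solve-∀
    (q , cq) ⊗ (r , cr) = _*Q_ p q r , coherent {_*Q_ p q r} (λ n →
        ∣-resp (expand (x q (suc n)) (x q n) (x r (suc n)) (x r n))
          (∣.∣m∣n⇒∣m+n (∣.∣n⇒∣m*n (x q (suc n)) (coherent-step {x r} cr n))
                       (∣.∣m⇒∣m*n (x r n) (coherent-step {x q} cq n))))
      where
      expand : ∀ c d f g → c * (f - g) + (c - d) * g ≡ c * f - d * g
      expand = solve-∀

    ⊝_ : CQ → CQ
    ⊝ (qp e₀ x₀ , c) = qp e₀ (λ n → - x₀ n) , coherent {qp e₀ (λ n → - x₀ n)} (λ n →
        ∣-resp (expand (x₀ (suc n)) (x₀ n)) (∣.∣m⇒∣-m (coherent-step {x₀} c n)))
      where
      expand : ∀ a b → - (a - b) ≡ - a - - b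
      expand = solve-∀

    ιC : ZP → CQ
    ιC z = ι z , coherent {ι z} (λ n → ∣-resp (sym (ℤP.+-inverseʳ (num z))) (∣-zero (P n)))

  0C 1C : CQ
  0C = ιC (zp (+ 0) 0)
  1C = ιC (zp (+ 1) 0)

  -- The ring laws hold on representatives up to powers of p that are
  -- rewritten by  p^(i+j) = p^i p^j  and then normalised.
  opaque
    unfolding _⊕_ _⊖_ _⊗_ ⊝_ ιC

    ⊕-assoc : ∀ a b c → (a ⊕ b) ⊕ c ≋ a ⊕ (b ⊕ c)
    ⊕-assoc (qa , _) (qb , _) (qc , _) = ≋-by-≡ λ n →
      split (P (e qa)) (P (e qb)) (P (e qc)) _ _ _ _ (x qa n) (x qb n) (x qc n)
        (P-+ (e qa) (e qb)) (P-+ (e qb) (e qc)) (P-+ (e qa) (e qb ℕ.+ e qc)) (P-+ (e qa ℕ.+ e qb) (e qc))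
      where
      normal : ∀ A B C a b c → (A * (B * C)) * (C * (B * a + A * b) + (A * B) * c)
                             ≡ ((A * B) * C) * ((B * C) * a + A * (C * b + B * c))
      normal = solve-∀
      split : ∀ A B C AB BC A-BC AB-C a b c → AB ≡ A * B → BC ≡ B * C → A-BC ≡ A * BC → AB-C ≡ AB * C →
              A-BC * (C * (B * a + A * b) + AB * c) ≡ AB-C * (BC * a + A * (C * b + B * c))
      split A B C _ _ _ _ a b c refl refl refl refl = normal A B C a b c

    ⊕-comm : ∀ a b → a ⊕ b ≋ b ⊕ a
    ⊕-comm (qa , _) (qb , _) = ≋-by-≡ λ n →
      split (P (e qa)) (P (e qb)) _ _ (x qa n) (x qb n) (P-+ (e qa) (e qb)) (P-+ (e qb) (e qa))
      where
      normal : ∀ A B a b → (B * A) * (B * a + A * b) ≡ (A * B) * (A * b + B * a)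
      normal = solve-∀
      split : ∀ A B AB BA a b → AB ≡ A * B → BA ≡ B * A → BA * (B * a + A * b) ≡ AB * (A * b + B * a)
      split A B _ _ a b refl refl = normal A B a b

    ⊕-identityˡ : ∀ a → 0C ⊕ a ≋ a
    ⊕-identityˡ (qa , _) = ≋-by-≡ λ n → normal (P (e qa)) (x qa n)
      where
      normal : ∀ A a → A * (A * + 0 + + 1 * a) ≡ A * a
      normal = solve-∀

    ⊕-identityʳ : ∀ a → a ⊕ 0C ≋ a
    ⊕-identityʳ (qa , _) = ≋-by-≡ λ n →
      split (P (e qa)) _ (x qa n) (cong P (ℕP.+-identityʳ (e qa)))
      where
      normal : ∀ A a → A * (+ 1 * a + A * + 0) ≡ A * a
      normal = solve-∀
      split : ∀ A A0 a → A0 ≡ A → A * (+ 1 * a + A * + 0) ≡ A0 * a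
      split A _ a refl = normal A a

    ⊕-inverseˡ : ∀ a → ⊝ a ⊕ a ≋ 0C
    ⊕-inverseˡ (qa , _) = ≋-by-≡ λ n → normal (P (e qa)) (P (e qa ℕ.+ e qa)) (x qa n)
      where
      normal : ∀ A AA a → + 1 * (A * - a + A * a) ≡ AA * + 0
      normal = solve-∀

    ⊕-inverseʳ : ∀ a → a ⊕ ⊝ a ≋ 0C
    ⊕-inverseʳ (qa , _) = ≋-by-≡ λ n → normal (P (e qa)) (P (e qa ℕ.+ e qa)) (x qa n)
      where
      normal : ∀ A AA a → + 1 * (A * a + A * - a) ≡ AA * + 0
      normal = solve-∀

    ⊝-cong : ∀ {a b} → a ≋ b → ⊝ a ≋ ⊝ b
    ⊝-cong {qa , ca} {qb , cb} (by-≈ h) = ≋-by-∣ {⊝ (qa , ca)} {⊝ (qb , cb)} λ n →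
      ∣-resp (normal (P (e qa)) (P (e qb)) (x qa n) (x qb n)) (∣.∣m⇒∣-m (≈⇒SameValue {qa} {qb} h n))
      where
      normal : ∀ A B a b → - (B * a - A * b) ≡ B * - a - A * - b
      normal = solve-∀

    ⊕-cong : ∀ {a a′ b b′} → a ≋ a′ → b ≋ b′ → a ⊕ b ≋ a′ ⊕ b′
    ⊕-cong {qa , ca} {qa′ , ca′} {qb , cb} {qb′ , cb′} (by-≈ h₁) (by-≈ h₂) =
      ≋-by-∣ {(qa , ca) ⊕ (qb , cb)} {(qa′ , ca′) ⊕ (qb′ , cb′)} λ n →
      ∣-resp (split (P (e qa)) (P (e qa′)) (P (e qb)) (P (e qb′)) _ _ (x qa n) (x qa′ n) (x qb n) (x qb′ n)
                    (P-+ (e qa) (e qb)) (P-+ (e qa′) (e qb′)))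
        (∣.∣m∣n⇒∣m+n (∣.∣n⇒∣m*n (P (e qb) * P (e qb′)) (≈⇒SameValue {qa} {qa′} h₁ n))
                     (∣.∣n⇒∣m*n (P (e qa) * P (e qa′)) (≈⇒SameValue {qb} {qb′} h₂ n)))
      where
      normal : ∀ A A′ B B′ a a′ b b′ → B * B′ * (A′ * a - A * a′) + A * A′ * (B′ * b - B * b′)
             ≡ (A′ * B′) * (B * a + A * b) - (A * B) * (B′ * a′ + A′ * b′)
      normal = solve-∀
      split : ∀ A A′ B B′ AB AB′ a a′ b b′ → AB ≡ A * B → AB′ ≡ A′ * B′ →
              B * B′ * (A′ * a - A * a′) + A * A′ * (B′ * b - B * b′)
              ≡ AB′ * (B * a + A * b) - AB * (B′ * a′ + A′ * b′)
      split A A′ B B′ _ _ a a′ b b′ refl refl = normal A A′ B B′ a a′ b b′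

    ⊗-cong : ∀ {a a′ b b′} → a ≋ a′ → b ≋ b′ → a ⊗ b ≋ a′ ⊗ b′
    ⊗-cong {qa , ca} {qa′ , ca′} {qb , cb} {qb′ , cb′} (by-≈ h₁) (by-≈ h₂) =
      ≋-by-∣ {(qa , ca) ⊗ (qb , cb)} {(qa′ , ca′) ⊗ (qb′ , cb′)} λ n →
      ∣-resp (split (P (e qa)) (P (e qa′)) (P (e qb)) (P (e qb′)) _ _ (x qa n) (x qa′ n) (x qb n) (x qb′ n)
                    (P-+ (e qa) (e qb)) (P-+ (e qa′) (e qb′)))
        (∣.∣m∣n⇒∣m+n (∣.∣n⇒∣m*n (P (e qb′) * x qb n) (≈⇒SameValue {qa} {qa′} h₁ n))
                     (∣.∣n⇒∣m*n (P (e qa) * x qa′ n) (≈⇒SameValue {qb} {qb′} h₂ n)))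
      where
      normal : ∀ A A′ B B′ a a′ b b′ → B′ * b * (A′ * a - A * a′) + A * a′ * (B′ * b - B * b′)
             ≡ (A′ * B′) * (a * b) - (A * B) * (a′ * b′)
      normal = solve-∀
      split : ∀ A A′ B B′ AB AB′ a a′ b b′ → AB ≡ A * B → AB′ ≡ A′ * B′ →
              B′ * b * (A′ * a - A * a′) + A * a′ * (B′ * b - B * b′) ≡ AB′ * (a * b) - AB * (a′ * b′)
      split A A′ B B′ _ _ a a′ b b′ refl refl = normal A A′ B B′ a a′ b b′

    ⊗-assoc : ∀ a b c → (a ⊗ b) ⊗ c ≋ a ⊗ (b ⊗ c)
    ⊗-assoc (qa , _) (qb , _) (qc , _) = ≋-by-≡ λ n →
      cong₂ _*_ (cong P (sym (ℕP.+-assoc (e qa) (e qb) (e qc)))) (ℤP.*-assoc (x qa n) (x qb n) (x qc n))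

    ⊗-comm : ∀ a b → a ⊗ b ≋ b ⊗ a
    ⊗-comm (qa , _) (qb , _) = ≋-by-≡ λ n →
      cong₂ _*_ (cong P (ℕP.+-comm (e qb) (e qa))) (ℤP.*-comm (x qa n) (x qb n))

    ⊗-identityˡ : ∀ a → 1C ⊗ a ≋ a
    ⊗-identityˡ (qa , _) = ≋-by-≡ λ n → cong (P (e qa) *_) (ℤP.*-identityˡ (x qa n))

    ⊗-identityʳ : ∀ a → a ⊗ 1C ≋ a
    ⊗-identityʳ (qa , _) = ≋-by-≡ λ n →
      cong₂ _*_ (cong P (sym (ℕP.+-identityʳ (e qa)))) (ℤP.*-identityʳ (x qa n))

    ⊗-distribˡ : ∀ a b c → a ⊗ (b ⊕ c) ≋ a ⊗ b ⊕ a ⊗ c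
    ⊗-distribˡ (qa , _) (qb , _) (qc , _) = ≋-by-≡ λ n →
      split (P (e qa)) (P (e qb)) (P (e qc)) _ _ _ _ _ (x qa n) (x qb n) (x qc n)
        (P-+ (e qa) (e qb)) (P-+ (e qa) (e qc)) (P-+ (e qb) (e qc))
        (P-+ (e qa ℕ.+ e qb) (e qa ℕ.+ e qc)) (P-+ (e qa) (e qb ℕ.+ e qc))
      where
      normal : ∀ A B C a b c → ((A * B) * (A * C)) * (a * (C * b + B * c))
             ≡ (A * (B * C)) * ((A * C) * (a * b) + (A * B) * (a * c))
      normal = solve-∀
      split : ∀ A B C AB AC BC AB-AC A-BC a b c → AB ≡ A * B → AC ≡ A * C → BC ≡ B * C →
              AB-AC ≡ AB * AC → A-BC ≡ A * BC →
              AB-AC * (a * (C * b + B * c)) ≡ A-BC * (AC * (a * b) + AB * (a * c))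
      split A B C _ _ _ _ _ a b c refl refl refl refl refl = normal A B C a b c

    ⊖-≋ : ∀ a b → a ⊖ b ≋ a ⊕ ⊝ b
    ⊖-≋ (qa , _) (qb , _) = ≋-by-≡ λ n → cong (P (e qa ℕ.+ e qb) *_)
      (cong (λ t → P (e qb) * x qa n + t) (ℤP.neg-distribʳ-* (P (e qa)) (x qb n)))

  ⊗-distribʳ : ∀ a b c → (b ⊕ c) ⊗ a ≋ b ⊗ a ⊕ c ⊗ a
  ⊗-distribʳ a b c = ≋-trans {(b ⊕ c) ⊗ a} {a ⊗ (b ⊕ c)} (⊗-comm (b ⊕ c) a)
    (≋-trans {a ⊗ (b ⊕ c)} {a ⊗ b ⊕ a ⊗ c} (⊗-distribˡ a b c)
      (⊕-cong {a ⊗ b} {b ⊗ a} {a ⊗ c} {c ⊗ a} (⊗-comm a b) (⊗-comm a c)))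

  isCommutativeRing : IsCommutativeRing _≋_ _⊕_ _⊗_ ⊝_ 0C 1C
  isCommutativeRing = record
    { isRing = record
      { +-isAbelianGroup = record
        { isGroup = record
          { isMonoid = record
            { isSemigroup = record
              { isMagma = record
                { isEquivalence = ≋-isEquivalence
                ; ∙-cong = λ {a} {a′} {b} {b′} → ⊕-cong {a} {a′} {b} {b′} }
              ; assoc = ⊕-assoc }
            ; identity = ⊕-identityˡ , ⊕-identityʳ }
          ; inverse = ⊕-inverseˡ , ⊕-inverseʳ
          ; ⁻¹-cong = λ {a} {b} → ⊝-cong {a} {b} }
        ; comm = ⊕-comm }
      ; *-cong = λ {a} {a′} {b} {b′} → ⊗-cong {a} {a′} {b} {b′}
      ; *-assoc = ⊗-assoc
      ; *-identity = ⊗-identityˡ , ⊗-identityʳ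
      ; distrib = ⊗-distribˡ , ⊗-distribʳ }
    ; *-comm = ⊗-comm }

  ring : CommutativeRing _ _
  ring = record { isCommutativeRing = isCommutativeRing }

  opaque
    unfolding _⊕_ _⊗_ ⊝_ ιC

    ℤ⟶CQ : ℤ-rawRing -Raw-AlmostCommutative⟶ fromCommutativeRing ring
    ℤ⟶CQ = record
      { ⟦_⟧    = λ z → ιC (zp z 0)
      ; +-homo = λ a b → ≋-by-≡ λ _ → add-normal a b
      ; *-homo = λ a b → ≋-by-≡ λ _ → refl
      ; -‿homo = λ a → ≋-by-≡ λ _ → refl
      ; 0-homo = ≋-refl
      ; 1-homo = ≋-refl }
      where
      add-normal : ∀ a b → + 1 * (a + b) ≡ + 1 * (+ 1 * a + + 1 * b)
      add-normal = solve-∀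

module Valuation (p : ℕ) .{{_ : ℕ.NonZero p}} where
  open PowersOfP p
  open CoherentRing p
  open import Data.Integer using (_+_; _-_; _*_; -_)
  open ∣ using (_∣_)
  open import Data.Nat.Tactic.RingSolver as ℕSolver using ()
  open import Relation.Nullary using (Dec; yes; no)

  infix 4 _ν≥_
  _ν≥_ : CQ → ℕ → Set
  a ν≥ m = P (m ℕ.+ e (rep a)) ∣ x (rep a) (m ℕ.+ e (rep a))

  ν≥-mono : ∀ a {m m′} → m′ ℕ.≤ m → a ν≥ m → a ν≥ m′
  ν≥-mono (q , c) m′≤m h = residue-restrict {x q} c (ℕP.+-monoˡ-≤ (e q) m′≤m) h

  -- compare at the common precision m + e₁ + e₂ and cancel p^e₁
  ν≥-resp : ∀ {a b} m → a ≋ b → a ν≥ m → b ν≥ m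
  ν≥-resp {q₁ , c₁} {q₂ , c₂} m (by-≈ a≈b) h =
    residue-transport {x q₂} c₂ {j = N} (ℕP.≤-trans (ℕP.m≤n+m (m ℕ.+ e₂) e₁) (ℕP.≤-reflexive (sym N≡))) ℕP.≤-refl
      (P-cancel e₁ (m ℕ.+ e₂) (x q₂ N) (subst (λ k → P k ∣ P e₁ * x q₂ N) N≡ second-term))
    where
    e₁ = e q₁ ; e₂ = e q₂
    N = m ℕ.+ e₁ ℕ.+ e₂
    shuffle : ∀ m a b → m ℕ.+ a ℕ.+ b ≡ a ℕ.+ (m ℕ.+ b)
    shuffle = ℕSolver.solve-∀
    N≡ : N ≡ e₁ ℕ.+ (m ℕ.+ e₂)
    N≡ = shuffle m e₁ e₂
    first-term : P N ∣ P e₂ * x q₁ N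
    first-term = subst (λ k → P k ∣ P e₂ * x q₁ N) (ℕP.+-comm e₂ (m ℕ.+ e₁))
      (P-scale e₂ (m ℕ.+ e₁) _ (residue-transport {x q₁} c₁ ℕP.≤-refl (ℕP.m≤m+n (m ℕ.+ e₁) e₂) h))
    difference : ∀ u v → u - (u - v) ≡ v
    difference = solve-∀
    second-term : P N ∣ P e₁ * x q₂ N
    second-term = ∣-resp (difference (P e₂ * x q₁ N) (P e₁ * x q₂ N)) (∣.∣m∣n⇒∣m-n first-term (≈⇒SameValue {q₁} {q₂} a≈b N))

  opaque
    unfolding _⊕_ _⊗_ ⊝_ ιC

    ν≥-0 : ∀ m → 0C ν≥ m
    ν≥-0 m = ∣-zero (P (m ℕ.+ 0))

    ν≥-1 : 1C ν≥ 0
    ν≥-1 = ∣.∣-refl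

    ν≥-⊕ : ∀ a b m → a ν≥ m → b ν≥ m → (a ⊕ b) ν≥ m
    ν≥-⊕ (qa , ca) (qb , cb) m ha hb = ∣.∣m∣n⇒∣m+n (scaled {x qa} {e qb} {e qa} ca ha (shuffle₁ m (e qa) (e qb)))
                                                  (scaled {x qb} {e qa} {e qb} cb hb (shuffle₂ m (e qa) (e qb)))
      where
      J : ℕ
      J = m ℕ.+ (e qa ℕ.+ e qb)
      shuffle₁ : ∀ m a b → b ℕ.+ (m ℕ.+ a) ≡ m ℕ.+ (a ℕ.+ b)
      shuffle₁ = ℕSolver.solve-∀
      shuffle₂ : ∀ m a b → a ℕ.+ (m ℕ.+ b) ≡ m ℕ.+ (a ℕ.+ b)
      shuffle₂ = ℕSolver.solve-∀
      scaled : ∀ {y f f′} → CoherentSeq y → P (m ℕ.+ f′) ∣ y (m ℕ.+ f′) → f ℕ.+ (m ℕ.+ f′) ≡ J → P J ∣ P f * y J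
      scaled {y} {f} {f′} c h eq = subst (λ k → P k ∣ P f * y J) eq
        (P-scale f (m ℕ.+ f′) (y J) (residue-transport {y} c ℕP.≤-refl
          (ℕP.≤-trans (ℕP.m≤n+m (m ℕ.+ f′) f) (ℕP.≤-reflexive eq)) h))

    ν≥-⊝ : ∀ a m → a ν≥ m → (⊝ a) ν≥ m
    ν≥-⊝ (qa , ca) m h = ∣.∣m⇒∣-m h

    ν≥-⊗ : ∀ a b m₁ m₂ → a ν≥ m₁ → b ν≥ m₂ → (a ⊗ b) ν≥ (m₁ ℕ.+ m₂)
    ν≥-⊗ (qa , ca) (qb , cb) m₁ m₂ ha hb = subst (λ k → P k ∣ x qa J * x qb J) regroup
      (P-product {m₁ ℕ.+ e qa} {m₂ ℕ.+ e qb}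
        (residue-transport {x qa} ca {k = J} ℕP.≤-refl
          (ℕP.≤-trans (ℕP.m≤m+n (m₁ ℕ.+ e qa) (m₂ ℕ.+ e qb)) (ℕP.≤-reflexive regroup)) ha)
        (residue-transport {x qb} cb {k = J} ℕP.≤-refl
          (ℕP.≤-trans (ℕP.m≤n+m (m₂ ℕ.+ e qb) (m₁ ℕ.+ e qa)) (ℕP.≤-reflexive regroup)) hb))
      where
      J : ℕ
      J = m₁ ℕ.+ m₂ ℕ.+ (e qa ℕ.+ e qb)
      shuffle : ∀ m₁ m₂ a b → m₁ ℕ.+ a ℕ.+ (m₂ ℕ.+ b) ≡ m₁ ℕ.+ m₂ ℕ.+ (a ℕ.+ b)
      shuffle = ℕSolver.solve-∀
      regroup : m₁ ℕ.+ e qa ℕ.+ (m₂ ℕ.+ e qb) ≡ J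
      regroup = shuffle m₁ m₂ (e qa) (e qb)

    ν≥-ι⊗ : ∀ {r d i j m} a → P i ∣ r → a ν≥ j → m ℕ.+ d ℕ.≤ i ℕ.+ j → (ιC (zp r d) ⊗ a) ν≥ m
    ν≥-ι⊗ {r} {d} {i} {j} {m} (qa , ca) hr ha m+d≤i+j = by-cases (K ℕ.≤? j ℕ.+ e qa)
      where
      K : ℕ
      K = m ℕ.+ (d ℕ.+ e qa)
      K≤ : K ℕ.≤ i ℕ.+ (j ℕ.+ e qa)
      K≤ = ℕP.≤-trans (ℕP.≤-reflexive (sym (ℕP.+-assoc m d (e qa))))
             (ℕP.≤-trans (ℕP.+-monoˡ-≤ (e qa) m+d≤i+j) (ℕP.≤-reflexive (ℕP.+-assoc i j (e qa))))
      by-cases : Dec (K ℕ.≤ j ℕ.+ e qa) → P K ∣ r * x qa K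
      by-cases (yes K≤j) = ∣.∣n⇒∣m*n r (residue-restrict {x qa} ca K≤j ha)
      by-cases (no K≰j) = ∣-weaken {j = i ℕ.+ (j ℕ.+ e qa)} K≤ (P-product {i} {j ℕ.+ e qa} hr
        (residue-transport {x qa} ca {k = K} ℕP.≤-refl (ℕP.<⇒≤ (ℕP.≰⇒> K≰j)) ha))

  ν≥⇒ValGe : ∀ a m → a ν≥ m → ValGe p (rep a) (+ m)
  ν≥⇒ValGe a m h k k≡ = subst (λ k → pw p k ℤD.∣ x (rep a) k) (sym (ℤP.+-injective k≡)) (∣.∣⇒∣ᵤ h)

  prevfsum : (ℕ → ℕ) → ℕ → ℕ
  prevfsum ℓ zero    = 0
  prevfsum ℓ (suc n) = fsum ℓ n

  valuation-growth : ∀ (ℓ : ℕ → ℕ) (δ ε u w : ℕ → CQ) →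
    (∀ n → w (suc n) ≡ u n) →
    (∀ n → u (suc n) ≋ ⊝ (δ (suc n) ⊗ u n ⊕ ε (suc n) ⊗ w n)) →
    (∀ n → δ (suc n) ν≥ ℓ (suc n)) → (∀ n → ε (suc n) ν≥ ℓ (suc n) ℕ.+ ℓ n) →
    u 0 ν≥ ℓ 0 → w 0 ν≥ 0 →
    ∀ n → u n ν≥ fsum ℓ n × w n ν≥ prevfsum ℓ n
  valuation-growth ℓ δ ε u w shift recursion νδ νε νu₀ νw₀ = growth
    where
    growth : ∀ n → u n ν≥ fsum ℓ n × w n ν≥ prevfsum ℓ n
    growth zero = νu₀ , νw₀
    growth (suc n) = ν≥-resp (fsum ℓ (suc n)) (≋-sym (recursion n))
                       (ν≥-⊝ _ _ (ν≥-⊕ _ _ _ first second))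
                   , subst (_ν≥ fsum ℓ n) (sym (shift n)) (proj₁ (growth n))
      where
      ℓ′ = ℓ (suc n)
      fsum-split : ∀ n → fsum ℓ n ≡ prevfsum ℓ n ℕ.+ ℓ n
      fsum-split zero    = refl
      fsum-split (suc n) = refl
      first : (δ (suc n) ⊗ u n) ν≥ fsum ℓ (suc n)
      first = subst ((δ (suc n) ⊗ u n) ν≥_) (ℕP.+-comm ℓ′ (fsum ℓ n))
                (ν≥-⊗ (δ (suc n)) (u n) ℓ′ (fsum ℓ n) (νδ n) (proj₁ (growth n)))
      reorder : ∀ a b c → c ℕ.+ b ℕ.+ a ≡ a ℕ.+ b ℕ.+ c
      reorder = ℕSolver.solve-∀
      second : (ε (suc n) ⊗ w n) ν≥ fsum ℓ (suc n)
      second = subst ((ε (suc n) ⊗ w n) ν≥_) (trans (reorder (prevfsum ℓ n) (ℓ n) ℓ′) (cong (ℕ._+ ℓ′) (sym (fsum-split n))))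
                 (ν≥-⊗ (ε (suc n)) (w n) (ℓ′ ℕ.+ ℓ n) (prevfsum ℓ n) (νε n) (proj₂ (growth n)))

-- Balanced base-p digits: the truncated digit sum of z agrees with z
-- modulo p^m, so Browkin's s(α) agrees with α to valuation ≥ 1.
module BalancedDigits (p : ℕ) .{{_ : ℕ.NonZero p}} where
  open PowersOfP p
  open import Data.Integer using (_+_; _-_; _*_; -_)
  open ∣ using (_∣_)
  open import Data.Integer.DivMod using (_/ℕ_; _%ℕ_; a≡a%ℕn+[a/ℕn]*n; n%ℕd<d)
  import Data.Nat.Divisibility as ℕD
  open import Relation.Nullary using (yes; no)
  open import Data.Empty using (⊥-elim)

  bal-congruent : ∀ z → + p ∣ z - bal p z
  bal-congruent z with (z %ℕ p) ℕ.≤? (p ℕ./ 2)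
  ... | yes _ = divides (z /ℕ p) (trans (cong (_- + (z %ℕ p)) (a≡a%ℕn+[a/ℕn]*n z p)) (drop (+ (z %ℕ p)) _))
    where
    drop : ∀ r t → r + t - r ≡ t
    drop = solve-∀
  ... | no _ = divides (z /ℕ p + + 1) (trans (cong (_- (+ (z %ℕ p) - + p)) (a≡a%ℕn+[a/ℕn]*n z p))
                                             (drop (+ (z %ℕ p)) (z /ℕ p) (+ p)))
    where
    drop : ∀ r q p → r + q * p - (r - p) ≡ (q + + 1) * p
    drop = solve-∀

  -- division by p is exact on multiples of p: the remainder, a multiple of
  -- p below p, vanishes
  exact-quotient : ∀ u → + p ∣ u → u ≡ (u /ℕ p) * + p
  exact-quotient u p∣u = trans (a≡a%ℕn+[a/ℕn]*n u p)
                               (trans (cong (λ r → + r + (u /ℕ p) * + p) remainder-zero) (ℤP.+-identityˡ _))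
    where
    r = u %ℕ p
    drop : ∀ a b → a + b - b ≡ a
    drop = solve-∀
    p∣r : + p ∣ + r
    p∣r = ∣-resp (trans (cong (_- (u /ℕ p) * + p) (a≡a%ℕn+[a/ℕn]*n u p)) (drop (+ r) ((u /ℕ p) * + p)))
            (∣.∣m∣n⇒∣m-n p∣u (∣.∣n⇒∣m*n (u /ℕ p) (∣.∣-refl {+ p})))
    remainder-zero : r ≡ 0
    remainder-zero with r in r≡
    ... | zero  = refl
    ... | suc _ = ⊥-elim (ℕD.>⇒∤ (subst (ℕ._< p) r≡ (n%ℕd<d u p)) (subst (p ℕD.∣_) r≡ (∣.∣⇒∣ᵤ p∣r)))

  digitSum-congruent : ∀ m z → P m ∣ digitSum p m z - z
  digitSum-congruent zero z = divides (digitSum p zero z - z) (sym (ℤP.*-identityʳ _))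
  digitSum-congruent (suc m) z = subst (_∣ digitSum p (suc m) z - z) (sym (ℤP.pos-* p (p ℕ.^ m)))
    (∣-resp (sym shift) (∣.*-monoʳ-∣ (+ p) (digitSum-congruent m w)))
    where
    w = (z - bal p z) /ℕ p
    -- digitSum (1+m) z − z = p (digitSum m w − w), as z − bal z = w p
    rearrange : ∀ b z d w p → z - b ≡ w * p → b + p * d - z ≡ p * (d - w)
    rearrange b z d w p h = trans (regroup b z d p) (trans (cong (λ t → p * d - t) h) (factor d w p))
      where
      regroup : ∀ b z d p → b + p * d - z ≡ p * d - (z - b)
      regroup = solve-∀
      factor : ∀ d w p → p * d - w * p ≡ p * (d - w)
      factor = solve-∀
    shift : digitSum p (suc m) z - z ≡ + p * (digitSum p m w - w)
    shift = rearrange (bal p z) z (digitSum p m w) w (+ p) (exact-quotient (z - bal p z) (bal-congruent z))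

module PrimePowers (p : ℕ) .{{p≢0 : ℕ.NonZero p}} (p-prime : Prime p) where
  open PowersOfP p
  open import Data.Integer using (_+_; _-_; _*_; -_)
  open ∣ using (_∣_)
  import Data.Nat.Divisibility as ℕD
  import Data.Nat.DivMod as ℕDM
  open import Data.Nat.Primality using (euclidsLemma; prime⇒nonTrivial)
  open import Data.Sum using (inj₁; inj₂)
  open import Data.Empty using (⊥-elim)
  open import Relation.Nullary using (¬_; yes; no)

  1<p : 1 ℕ.< p
  1<p = ℕ.nonTrivial⇒n>1 p {{prime⇒nonTrivial p-prime}}

  p∤1 : ¬ (+ p ∣ + 1)
  p∤1 h = ℕP.<⇒≢ 1<p (sym (ℕD.∣1⇒≡1 (∣.∣⇒∣ᵤ h)))

  euclid-power : ∀ {a} → ¬ (p ℕD.∣ a) → ∀ w b → (p ℕ.^ w) ℕD.∣ a ℕ.* b → (p ℕ.^ w) ℕD.∣ b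
  euclid-power p∤a zero b h = ℕD.1∣ b
  euclid-power {a} p∤a (suc w) b h with euclidsLemma a b p-prime (ℕD.∣-trans (ℕD.m∣m*n (p ℕ.^ w)) h)
  ... | inj₁ p∣a = ⊥-elim (p∤a p∣a)
  ... | inj₂ (ℕD.divides b′ refl) =
    subst (p ℕ.* p ℕ.^ w ℕD.∣_) (ℕP.*-comm p b′)
      (ℕD.*-monoʳ-∣ p (euclid-power p∤a w b′
        (ℕD.*-cancelˡ-∣ p (subst (p ℕ.* p ℕ.^ w ℕD.∣_) (swap a b′ p) h))))
    where
    swap : ∀ a b p → a ℕ.* (b ℕ.* p) ≡ p ℕ.* (a ℕ.* b)
    swap a b p = trans (sym (ℕP.*-assoc a b p)) (ℕP.*-comm (a ℕ.* b) p)

  euclid-power-ℤ : ∀ w {u y} → ¬ (+ p ∣ u) → P w ∣ u * y → P w ∣ y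
  euclid-power-ℤ w {u} {y} p∤u h = ∣.∣ᵤ⇒∣ (euclid-power (λ p∣u → p∤u (∣.∣ᵤ⇒∣ p∣u)) w ℤ.∣ y ∣
    (subst ((p ℕ.^ w) ℕD.∣_) (ℤP.abs-* u y) (∣.∣⇒∣ᵤ h)))

  ExactPower : ℕ → ℤ → Set
  ExactPower v z = P v ∣ z × ¬ (P (suc v) ∣ z)

  νℕ-fuel-exact : ∀ f n → 0 ℕ.< n → n ℕ.≤ f →
    (p ℕ.^ νℕ-fuel p f n) ℕD.∣ n × ¬ ((p ℕ.^ suc (νℕ-fuel p f n)) ℕD.∣ n)
  νℕ-fuel-exact zero n 0<n n≤0 = ⊥-elim (ℕP.<⇒≱ 0<n n≤0)
  νℕ-fuel-exact (suc f) n 0<n n≤f with p ℕD.∣? n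
  ... | no p∤n = ℕD.1∣ n , λ h → p∤n (ℕD.∣-trans (ℕD.∣-reflexive (sym (ℕP.*-identityʳ p))) h)
  ... | yes (ℕD.divides q refl) rewrite ℕDM.m*n/n≡m q p {{p≢0}} =
    subst (p ℕ.* p ℕ.^ v ℕD.∣_) (ℕP.*-comm p q) (ℕD.*-monoʳ-∣ p (proj₁ exact-q)) ,
    λ h → proj₂ exact-q (ℕD.*-cancelˡ-∣ p (subst (p ℕ.* (p ℕ.* p ℕ.^ v) ℕD.∣_) (ℕP.*-comm q p) h))
    where
    positive-factor : ∀ q → 0 ℕ.< q ℕ.* p → 0 ℕ.< q
    positive-factor (suc _) _ = ℕ.z<s
    0<q : 0 ℕ.< q
    0<q = positive-factor q 0<n
    exact-q = νℕ-fuel-exact f q 0<q (ℕP.≤-pred (ℕP.≤-trans (ℕP.m<m*n q p {{ℕ.>-nonZero 0<q}} 1<p) n≤f))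
    v = νℕ-fuel p f q

  νℕ-exact : ∀ r → r ≢ + 0 → ExactPower (νℕ p ℤ.∣ r ∣) r
  νℕ-exact r r≢0 = ∣.∣ᵤ⇒∣ (proj₁ exact) , λ h → proj₂ exact (∣.∣⇒∣ᵤ h)
    where
    0<∣r∣ : 0 ℕ.< ℤ.∣ r ∣
    0<∣r∣ = ℕP.n≢0⇒n>0 (λ ∣r∣≡0 → r≢0 (ℤP.∣i∣≡0⇒i≡0 ∣r∣≡0))
    exact = νℕ-fuel-exact ℤ.∣ r ∣ ℤ.∣ r ∣ 0<∣r∣ ℕP.≤-refl

  exact-power-transfer : ∀ {v c r z} → v ℕ.≤ c → P (suc c) ∣ r - z → ExactPower v r → ExactPower v z
  exact-power-transfer {v} {c} {r} {z} v≤c r≡z (p^v∣r , p^v+1∤r) =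
    ∣-resp (back r z) (∣.∣m∣n⇒∣m-n p^v∣r (∣-weaken (ℕP.m≤n⇒m≤1+n v≤c) r≡z)) ,
    λ p^v+1∣z → p^v+1∤r (∣-resp (forth r z) (∣.∣m∣n⇒∣m+n (∣-weaken (ℕ.s≤s v≤c) r≡z) p^v+1∣z))
    where
    back : ∀ r z → r - (r - z) ≡ z
    back = solve-∀
    forth : ∀ r z → r - z + z ≡ r
    forth = solve-∀

  cofactor : ∀ {c v X Y} → v ℕ.≤ c → P (suc c) ∣ X * Y - P c → ExactPower v X → P (c ℕ.∸ v) ∣ Y
  cofactor {c} {v} {X} {Y} v≤c XY≡p^c (divides u X≡uP , p^v+1∤X) =
    euclid-power-ℤ w p∤u (∣-resp (forth (u * Y) (P w)) (∣.∣m∣n⇒∣m+n reduced (∣.∣-refl {P w})))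
    where
    w = c ℕ.∸ v
    c≡ : c ≡ v ℕ.+ w
    c≡ = sym (ℕP.m+[n∸m]≡n v≤c)
    p∤u : ¬ (+ p ∣ u)
    p∤u (divides t u≡tp) = p^v+1∤X (divides t (begin-X))
      where
      begin-X : X ≡ t * P (suc v)
      begin-X = trans X≡uP (trans (cong (_* P v) u≡tp)
                  (trans (ℤP.*-assoc t (+ p) (P v)) (cong (t *_) (sym (ℤP.pos-* p (p ℕ.^ v))))))
    factor : ∀ u y a b → u * a * y - a * b ≡ a * (u * y - b)
    factor = solve-∀
    forth : ∀ a b → a - b + b ≡ a
    forth = solve-∀
    -- X Y − p^c = p^v (u Y − p^w)
    split : P (v ℕ.+ suc w) ∣ P v * (u * Y - P w)
    split = subst (λ k → P k ∣ P v * (u * Y - P w)) (trans (cong suc c≡) (sym (ℕP.+-suc v w)))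
      (∣-resp (trans (cong (λ t → t * Y - P c) X≡uP)
                (trans (cong (λ t → u * P v * Y - t) (trans (cong P c≡) (P-+ v w))) (factor u Y (P v) (P w))))
              XY≡p^c)
    reduced : P w ∣ u * Y - P w
    reduced = ∣-weaken (ℕP.n≤1+n w) (P-cancel v (suc w) _ split)

module FractionValuations (p : ℕ) .{{_ : ℕ.NonZero p}} where
  open import Data.Integer using (_+_; _-_; -_; -[1+_])
  open import Data.Empty using (⊥-elim)

  private
    bound₁ : ∀ L v d → + L ℤ.≤ - (+ v - + d) → L ℕ.+ v ℕ.≤ d
    bound₁ L v d h = ℤP.drop‿+≤+ (subst (+ (L ℕ.+ v) ℤ.≤_) (cancel (+ v) (+ d)) (ℤP.+-monoˡ-≤ (+ v) h))
      where
      cancel : ∀ v d → - (v - d) + v ≡ d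
      cancel = solve-∀

    bound₂ : ∀ L vb db va da → + L ℤ.≤ (+ vb - + db) - (+ va - + da) → L ℕ.+ db ℕ.+ va ℕ.≤ vb ℕ.+ da
    bound₂ L vb db va da h = ℤP.drop‿+≤+ (subst (+ (L ℕ.+ db ℕ.+ va) ℤ.≤_) (cancel (+ vb) (+ db) (+ va) (+ da))
      (ℤP.+-monoˡ-≤ (+ va) (ℤP.+-monoˡ-≤ (+ db) h)))
      where
      cancel : ∀ vb db va da → (vb - db) - (va - da) + db + va ≡ vb + da
      cancel = solve-∀

  νinv-bound : ∀ {r d L} → νinv p (zp r d) ≥∞ + L → r ≢ + 0 → L ℕ.+ νℕ p ℤ.∣ r ∣ ℕ.≤ d
  νinv-bound {+ zero}   _        r≢0 = ⊥-elim (r≢0 refl)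
  νinv-bound {+ suc _}  (fin≥ h) _   = bound₁ _ _ _ h
  νinv-bound { -[1+ _ ]} (fin≥ h) _   = bound₁ _ _ _ h

  νquot-bound : ∀ {rb db ra da L} → νquot p (zp rb db) (zp ra da) ≥∞ + L → rb ≢ + 0 → ra ≢ + 0 →
                L ℕ.+ db ℕ.+ νℕ p ℤ.∣ ra ∣ ℕ.≤ νℕ p ℤ.∣ rb ∣ ℕ.+ da
  νquot-bound {+ zero}                _        rb≢0 _    = ⊥-elim (rb≢0 refl)
  νquot-bound {+ suc _}  {ra = + zero} _       _    ra≢0 = ⊥-elim (ra≢0 refl)
  νquot-bound { -[1+ _ ]} {ra = + zero} _      _    ra≢0 = ⊥-elim (ra≢0 refl)
  νquot-bound {+ suc _}  {ra = + suc _}  (fin≥ h) _ _ = bound₂ _ _ _ _ _ h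
  νquot-bound {+ suc _}  {ra = -[1+ _ ]} (fin≥ h) _ _ = bound₂ _ _ _ _ _ h
  νquot-bound { -[1+ _ ]} {ra = + suc _}  (fin≥ h) _ _ = bound₂ _ _ _ _ _ h
  νquot-bound { -[1+ _ ]} {ra = -[1+ _ ]} (fin≥ h) _ _ = bound₂ _ _ _ _ _ h

module SFunction (p : ℕ) .{{_ : ℕ.NonZero p}} (p-prime : Prime p) where
  open PowersOfP p
  open CoherentRing p
  open Valuation p
  open BalancedDigits p
  open PrimePowers p p-prime
  open import Data.Integer using (_+_; _-_; _*_; -_)
  open ∣ using (_∣_)
  open import Relation.Nullary using (¬_)
  open IntegerCoefficientSolver ring ℤ⟶CQ using (solve; _:=_; _:+_; _:-_)

  s-num : CQ → ℤ
  s-num q = num (s p (rep q))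

  opaque
    unfolding _⊖_ _⊗_ ιC

    -- the digits of s(q) are those of the approximation x_{e+1} of q
    s-approximation : ∀ q → (q ⊖ ιC (s p (rep q))) ν≥ 1
    s-approximation (qp e₀ x₀ , c) =
      subst (λ k → P k ∣ P e₀ * x₀ J - P e₀ * r) (ℕP.+-suc e₀ e₀)
        (∣-resp (distribute (P e₀) (x₀ J) r) (P-scale e₀ (suc e₀) (x₀ J - r) close))
      where
      r : ℤ
      r = digitSum p (suc e₀) (x₀ (suc e₀))
      J : ℕ
      J = suc (e₀ ℕ.+ e₀)
      distribute : ∀ a u v → a * (u - v) ≡ a * u - a * v
      distribute = solve-∀
      telescope : ∀ a b r → a - b - (r - b) ≡ a - r
      telescope = solve-∀
      close : P (suc e₀) ∣ x₀ J - r
      close = ∣-resp (telescope (x₀ J) (x₀ (suc e₀)) r)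
        (∣.∣m∣n⇒∣m-n (coherent-gap {x₀} c (ℕ.s≤s (ℕP.m≤m+n e₀ e₀))) (digitSum-congruent (suc e₀) (x₀ (suc e₀))))

    ν≥-ι : ∀ {r d m} → P (m ℕ.+ d) ∣ r → ιC (zp r d) ν≥ m
    ν≥-ι h = h

    1C-not-ν≥1 : ¬ 1C ν≥ 1
    1C-not-ν≥1 h = p∤1 (∣.∣-trans (∣.∣-reflexive (cong +_ (sym (ℕP.*-identityʳ p)))) h)

    unit-congruence : ∀ q t → q ⊗ t ≋ 1C → ∀ n →
                      P n ∣ x (rep q) n * x (rep t) n - P (e (rep q) ℕ.+ e (rep t))
    unit-congruence (q , _) (t , _) (by-≈ qt≈1) n =
      ∣-resp (simplify (x q n * x t n) (P (e q ℕ.+ e t))) (≈⇒SameValue {_*Q_ p q t} {rep 1C} qt≈1 n)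
      where
      simplify : ∀ z c → + 1 * z - c * + 1 ≡ z - c
      simplify = solve-∀

  unit-not-ν≥1 : ∀ q t → q ⊗ t ≋ 1C → t ν≥ 1 → ¬ q ν≥ 1
  unit-not-ν≥1 q t qt≈1 νt νq = 1C-not-ν≥1 (ν≥-mono 1C (ℕ.s≤s ℕ.z≤n) (ν≥-resp 2 qt≈1 (ν≥-⊗ q t 1 1 νq νt)))

  -- were s(q) = 0, then q = (q − s(q)) + s(q) would have valuation ≥ 1
  s-nonzero : ∀ q t → q ⊗ t ≋ 1C → t ν≥ 1 → s-num q ≢ + 0
  s-nonzero q t qt≈1 νt r≡0 = unit-not-ν≥1 q t qt≈1 νt
    (ν≥-resp 1 (subtract-add q z)
      (ν≥-⊕ (q ⊕ ⊝ z) z 1 (ν≥-resp 1 (⊖-≋ q z) (s-approximation q))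
                          (ν≥-ι (subst (P (1 ℕ.+ e (rep q)) ∣_) (sym r≡0) (∣-zero (P (1 ℕ.+ e (rep q))))))))
    where
    z = ιC (s p (rep q))
    subtract-add : ∀ q z → q ⊕ ⊝ z ⊕ z ≋ q
    subtract-add = solve 2 (λ q z → q :- z :+ z := q) ≋-refl

  inverse-valuation : ∀ q t → q ⊗ t ≋ 1C → s-num q ≢ + 0 → νℕ p ℤ.∣ s-num q ∣ ℕ.≤ e (rep q) →
                      t ν≥ (e (rep q) ℕ.∸ νℕ p ℤ.∣ s-num q ∣)
  inverse-valuation q@(qp ea xa , ca) t@(qp et yt , ct) qt≈1 r≢0 v≤ea =
    residue-transport {yt} ct {j = N} w≤N ℕP.≤-refl
      (subst (λ k → P k ∣ yt N) (ℕP.+-∸-comm et v≤ea) (cofactor v≤c (unit-congruence q t qt≈1 N) exact))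
    where
    r = s-num q
    v = νℕ p ℤ.∣ r ∣
    N = suc (ea ℕ.+ et)
    v≤c : v ℕ.≤ ea ℕ.+ et
    v≤c = ℕP.≤-trans v≤ea (ℕP.m≤m+n ea et)
    w≤N : ea ℕ.∸ v ℕ.+ et ℕ.≤ N
    w≤N = ℕP.m≤n⇒m≤1+n (ℕP.+-monoˡ-≤ et (ℕP.m∸n≤m ea v))
    telescope : ∀ r a b → r - a - (b - a) ≡ r - b
    telescope = solve-∀
    -- r ≡ x_{ea+1} ≡ x_N  (mod p^(ea+1))
    r≡x : P (suc ea) ∣ r - xa N
    r≡x = ∣-resp (telescope r (xa (suc ea)) (xa N))
      (∣.∣m∣n⇒∣m-n (digitSum-congruent (suc ea) (xa (suc ea))) (coherent-gap {xa} ca (ℕ.s≤s (ℕP.m≤m+n ea et))))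
    exact : ExactPower v (xa N)
    exact = exact-power-transfer v≤ea r≡x (νℕ-exact r r≢0)

module JacobiPerronExpansion (p : ℕ) .{{_ : ℕ.NonZero p}} (p-prime : Prime p)
  (αs βs : ℕ → Qp) (jp : InfiniteJP p αs βs) where
  open PowersOfP p
  open CoherentRing p
  open Valuation p
  open PrimePowers p p-prime using (νℕ-exact)
  open FractionValuations p
  open SFunction p p-prime
  open InfiniteJP jp
  open ∣ using (_∣_)
  open import Relation.Nullary using (yes; no)
  open CommutativeRing ring using (+-congʳ; *-congˡ; *-identityˡ; zeroˡ)

  αC βC : ℕ → CQ
  αC k = αs k , coh-α k
  βC k = βs k , coh-β k

  a b : ℕ → ZP
  a = JP.a p αs βs
  b = JP.b p αs βs

  opaque
    unfolding _⊗_ _⊖_ ιC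
    α-relation : ∀ k → αC (suc k) ⊗ (βC k ⊖ ιC (b k)) ≋ 1C
    α-relation k = by-≈ (step-α k)
    β-relation : ∀ k → βC (suc k) ⊗ (βC k ⊖ ιC (b k)) ≋ αC k ⊖ ιC (a k)
    β-relation k = by-≈ (step-β k)

  step-α′ : ∀ k → αC (suc k) ⊗ (βC k ⊕ ⊝ ιC (b k)) ≋ 1C
  step-α′ k = ≋-trans (*-congˡ (≋-sym (⊖-≋ (βC k) (ιC (b k))))) (α-relation k)

  step-β′ : ∀ k → βC (suc k) ⊗ (βC k ⊕ ⊝ ιC (b k)) ≋ αC k ⊕ ⊝ ιC (a k)
  step-β′ k = ≋-trans (*-congˡ (≋-sym (⊖-≋ (βC k) (ιC (b k))))) (≋-trans (β-relation k) (⊖-≋ (αC k) (ιC (a k))))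

  open ConvergentAlgebra ring ℤ⟶CQ using (convergents; module Expansion)
  open Expansion (λ k → ιC (a k)) (λ k → ιC (b k)) αC βC step-α′ step-β′

  -- E_k = β_k − s(β_k)
  E-ν≥1 : ∀ k → E k ν≥ 1
  E-ν≥1 k = ν≥-resp 1 (⊖-≋ (βC k) (ιC (b k))) (s-approximation (βC k))

  -- a_{k+1} = a-num k / p^(a-exp k), and ν(a-num k) = a-ν k
  a-num : ℕ → ℤ
  a-num k = s-num (αC (suc k))
  a-exp a-ν : ℕ → ℕ
  a-exp k = e (αs (suc k))
  a-ν k = νℕ p ℤ.∣ a-num k ∣

  a-nonzero : ∀ k → a-num k ≢ + 0
  a-nonzero k = s-nonzero (αC (suc k)) (E k) (step-α′ k) (E-ν≥1 k)

  module Rα = Remainders (αC 0) (ιC (a 0) , 1C , 0C)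
  module Rβ = Remainders (βC 0) (ιC (b 0) , 0C , 1C)

  reps : CQ × CQ × CQ → Qp × Qp × Qp
  reps (u , v , w) = rep u , rep v , rep w

  opaque
    unfolding _⊕_ _⊗_ _⊖_ ιC

    reps-convergents : ∀ X₀ n → reps (convergents (λ k → ιC (a k)) (λ k → ιC (b k)) X₀ n) ≡ conv p a b (reps X₀) n
    reps-convergents X₀ zero    = refl
    reps-convergents X₀ (suc n) = cong step (reps-convergents X₀ n)
      where
      step : Qp × Qp × Qp → Qp × Qp × Qp
      step (u , v , w) = _+Q_ p (_+Q_ p (_*Q_ p (ι (a (suc n))) u) (_*Q_ p (ι (b (suc n))) v)) w , u , v

    Vα-rep : ∀ n → JP.Vα p αs βs n ≡ rep (proj₁ (Rα.C n) ⊗ αC 0 ⊖ proj₁ (Rα.X n))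
    Vα-rep n = cong₂ (λ c y → _-Q_ p (_*Q_ p c (αs 0)) y)
      (sym (cong proj₁ (reps-convergents (1C , 0C , 0C) n))) (sym (cong proj₁ (reps-convergents (ιC (a 0) , 1C , 0C) n)))

    Vβ-rep : ∀ n → JP.Vβ p αs βs n ≡ rep (proj₁ (Rβ.C n) ⊗ βC 0 ⊖ proj₁ (Rβ.X n))
    Vβ-rep n = cong₂ (λ c y → _-Q_ p (_*Q_ p c (βs 0)) y)
      (sym (cong proj₁ (reps-convergents (1C , 0C , 0C) n))) (sym (cong proj₁ (reps-convergents (ιC (b 0) , 0C , 1C) n)))

  remainder-ValGe : ∀ {γ X₀} n m → Remainders.V γ X₀ n ν≥ m →
    ValGe p (rep (proj₁ (Remainders.C γ X₀ n) ⊗ γ ⊖ proj₁ (Remainders.X γ X₀ n))) (+ m)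
  remainder-ValGe {γ} {X₀} n m h = ν≥⇒ValGe (Cγ ⊖ X) m (ν≥-resp m (≋-sym (⊖-≋ Cγ X)) h)
    where
    Cγ X : CQ
    Cγ = proj₁ (Remainders.C γ X₀ n) ⊗ γ
    X  = proj₁ (Remainders.X γ X₀ n)

  module Estimates (ℓ : ℕ → ℕ)
    (h-bound : ∀ n → JP.hh p αs βs (suc n) ≥∞ (+ ℓ n))
    (k-bound : ∀ n → JP.kk p αs βs (suc n) ≥∞ (+ (ℓ n ℕ.+ prevℓ ℓ n))) where

    L : ℕ → ℕ
    L k = ℓ k ℕ.+ prevℓ ℓ k

    -- k_{k+1} = a-exp k − a-ν k ≥ L k
    exponent-bound : ∀ k → L k ℕ.+ a-ν k ℕ.≤ a-exp k
    exponent-bound k = νinv-bound (k-bound k) (a-nonzero k)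

    a-ν≤a-exp : ∀ k → a-ν k ℕ.≤ a-exp k
    a-ν≤a-exp k = ℕP.≤-trans (ℕP.m≤n+m (a-ν k) (L k)) (exponent-bound k)

    -- ν(E_k) ≥ −ν(a_{k+1})
    E-ν≥-exact : ∀ k → E k ν≥ (a-exp k ℕ.∸ a-ν k)
    E-ν≥-exact k = inverse-valuation (αC (suc k)) (E k) (step-α′ k) (a-nonzero k) (a-ν≤a-exp k)

    E-ν≥ : ∀ k → E k ν≥ L k
    E-ν≥ k = ν≥-mono (E k) (ℕP.m+n≤o⇒m≤o∸n (L k) (exponent-bound k)) (E-ν≥-exact k)

    -- ν(b_{k+1} E_k) = h_{k+1} ≥ ℓ_k, treating b_{k+1} = 0 separately
    bE-ν≥ : ∀ k → (ιC (b (suc k)) ⊗ E k) ν≥ ℓ k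
    bE-ν≥ k with s-num (βC (suc k)) ℤ.≟ + 0
    ... | yes b≡0 = ν≥-ι⊗ {i = ℓ k ℕ.+ b-exp} (E k) (subst (P (ℓ k ℕ.+ b-exp) ∣_) (sym b≡0) (∣-zero _))
                      (E-ν≥-exact k) (ℕP.m≤m+n (ℓ k ℕ.+ b-exp) (a-exp k ℕ.∸ a-ν k))
      where b-exp = e (βs (suc k))
    ... | no b≢0 = ν≥-ι⊗ (E k) (proj₁ (νℕ-exact _ b≢0)) (E-ν≥-exact k)
                     (move-subtrahend (a-ν≤a-exp k) (νquot-bound (h-bound k) b≢0 (a-nonzero k)))
      where
      move-subtrahend : ∀ {L v w u} → v ℕ.≤ u → L ℕ.+ v ℕ.≤ w ℕ.+ u → L ℕ.≤ w ℕ.+ (u ℕ.∸ v)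
      move-subtrahend {L} {v} {w} {u} v≤u h = ℕP.+-cancelʳ-≤ v L (w ℕ.+ (u ℕ.∸ v))
        (ℕP.≤-trans h (ℕP.≤-reflexive (trans (cong (w ℕ.+_) (sym (ℕP.m∸n+n≡m v≤u)))
                                             (sym (ℕP.+-assoc w (u ℕ.∸ v) v)))))

    -- D_k = b_{k+1} E_k + E_{k+1} E_k
    D-ν≥ : ∀ k → D k ν≥ ℓ k
    D-ν≥ k = ν≥-resp (ℓ k) (≋-sym (D-split k))
      (ν≥-⊕ _ _ (ℓ k) (bE-ν≥ k)
        (ν≥-mono (E (suc k) ⊗ E k) ℓ≤ (ν≥-⊗ (E (suc k)) (E k) 1 _ (E-ν≥1 (suc k)) (E-ν≥-exact k))))
      where
      ℓ≤ : ℓ k ℕ.≤ 1 ℕ.+ (a-exp k ℕ.∸ a-ν k)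
      ℓ≤ = ℕP.≤-trans (ℕP.m≤m+n (ℓ k) (prevℓ ℓ k))
             (ℕP.≤-trans (ℕP.m+n≤o⇒m≤o∸n (L k) (exponent-bound k)) (ℕP.n≤1+n _))

    -- initially V^α_0 = D_0 and V^β_0 = E_0, while V_{−1} ∈ {−1, 0}
    Vα-ν≥ : ∀ n → Rα.V n ν≥ fsum ℓ n
    Vα-ν≥ n = proj₁ (valuation-growth ℓ D E Rα.V Rα.V′ (λ _ → refl) (Rα.remainder-recursion invariant-α)
      (λ n → D-ν≥ (suc n)) (λ n → E-ν≥ (suc n)) V₀ V₋₁ n)
      where
      V₀ : Rα.V 0 ν≥ ℓ 0
      V₀ = ν≥-resp (ℓ 0) (+-congʳ (≋-sym (*-identityˡ (αC 0)))) (D-ν≥ 0)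
      V₋₁ : Rα.V′ 0 ν≥ 0
      V₋₁ = ν≥-⊕ _ _ 0 (ν≥-resp 0 (≋-sym (zeroˡ (αC 0))) (ν≥-0 0)) (ν≥-⊝ 1C 0 ν≥-1)

    Vβ-ν≥ : ∀ n → Rβ.V n ν≥ fsum ℓ n
    Vβ-ν≥ n = proj₁ (valuation-growth ℓ D E Rβ.V Rβ.V′ (λ _ → refl) (Rβ.remainder-recursion invariant-β)
      (λ n → D-ν≥ (suc n)) (λ n → E-ν≥ (suc n)) V₀ V₋₁ n)
      where
      V₀ : Rβ.V 0 ν≥ ℓ 0
      V₀ = ν≥-resp (ℓ 0) (+-congʳ (≋-sym (*-identityˡ (βC 0))))
             (ν≥-mono (E 0) (ℕP.m≤m+n (ℓ 0) 0) (E-ν≥ 0))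
      V₋₁ : Rβ.V′ 0 ν≥ 0
      V₋₁ = ν≥-⊕ _ _ 0 (ν≥-resp 0 (≋-sym (zeroˡ (βC 0))) (ν≥-0 0)) (ν≥-⊝ 0C 0 (ν≥-0 0))

open import Data.Nat using (_<_; _%_; _+_; NonZero)

-- Proposition 6.  The remainders are computed in the ring of
-- representations, where they obey V_{n+1} = −(D_{n+1} V_n + E_{n+1} V_{n−1});
-- the estimates ν(D_k) ≥ ℓ_k, ν(E_k) ≥ ℓ_k + ℓ_{k−1} drive the induction.
proposition6 : (p : ℕ) .{{_ : NonZero p}} → Prime p → p % 2 ≡ 1 →
    (ℓ : ℕ → ℕ) → (∀ n → 0 < ℓ n) →
    (αs βs : ℕ → Qp) → InfiniteJP p αs βs →
    (∀ n → JP.hh p αs βs (suc n) ≥∞ (+ ℓ n)) →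
    (∀ n → JP.kk p αs βs (suc n) ≥∞ (+ (ℓ n + prevℓ ℓ n))) →
    ∀ n → ValGe p (JP.Vα p αs βs n) (+ fsum ℓ n)
        × ValGe p (JP.Vβ p αs βs n) (+ fsum ℓ n)
proposition6 p p-prime _ ℓ _ αs βs jp h-bound k-bound n =
  subst (λ V → ValGe p V (+ fsum ℓ n)) (sym (Vα-rep n)) (remainder-ValGe n (fsum ℓ n) (Vα-ν≥ n)) ,
  subst (λ V → ValGe p V (+ fsum ℓ n)) (sym (Vβ-rep n)) (remainder-ValGe n (fsum ℓ n) (Vβ-ν≥ n))
  where
  open JacobiPerronExpansion p p-prime αs βs jp
  open Estimates ℓ h-bound k-bound
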